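{- Let $G$ be a finite simple graph that is the union of two vertex-disjoint elementary cycles $C$ and $C'$ and an elementary path $P$ of length at least $1$ joining a vertex of $C$ to a vertex of $C'$, with $P$ internally vertex-disjoint from $C\cup C'$. Then $G$ is not separable.
   Context: A graph $G=(V,E)$ is separable if there exist non-negative real weights $w(e)$, $e\in E$, and a threshold $\alpha\in\mathbb{R}$ such that for every $E'\subseteq E$: $\sum_{e\in E'}w(e)\ge\alpha$ if and only if the spanning subgraph $(V,E')$ is connected.
   Formalization: The edge weights $w(e)$ and the threshold $\alpha$ are taken in ℚ rather than in the reals. -}

module Defs where

open import Data.Nat using (ℕ; zero; suc; _≤_)
open import Data.Fin using (Fin; zero; suc; fromℕ; inject₁)
open import Data.Fin.Subset using (Subset; _∈_)
open import Data.Vec using ([]; _∷_)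
open import Data.Bool using (true; false)
open import Data.Product using (Σ; ∃; _×_; _,_; proj₁; proj₂)
open import Data.Sum using (_⊎_)
open import Data.Rational using (ℚ; 0ℚ; _+_) renaming (_≤_ to _≤ℚ_)
open import Relation.Binary.PropositionalEquality using (_≡_; _≢_)
open import Relation.Binary.Construct.Closure.ReflexiveTransitive using (Star)
open import Function using (Injective)
open import Function.Bundles using (_⇔_)

Link : ∀ {n} → Fin n → Fin n → Fin n → Fin n → Set
Link a b u v = (u ≡ a × v ≡ b) ⊎ (u ≡ b × v ≡ a)

record Graph : Set where
  field
    n        : ℕ
    m        : ℕ
    ends     : Fin m → Fin n × Fin n
    loopless : ∀ e → proj₁ (ends e) ≢ proj₂ (ends e)
    simple   : ∀ e e' → Link (proj₁ (ends e)) (proj₂ (ends e))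
                              (proj₁ (ends e')) (proj₂ (ends e')) → e ≡ e'
open Graph public

GEdge : (G : Graph) → Fin (n G) → Fin (n G) → Set
GEdge G u v = ∃ λ e → Link (proj₁ (ends G e)) (proj₂ (ends G e)) u v

-- Spanning subgraph (V, E') with E' ⊆ E given as a subset of edge indices
Step : (G : Graph) → Subset (m G) → Fin (n G) → Fin (n G) → Set
Step G E' a b = ∃ λ e → e ∈ E' × Link (proj₁ (ends G e)) (proj₂ (ends G e)) a b

Connected : (G : Graph) → Subset (m G) → Set
Connected G E' = ∀ u v → Star (Step G E') u v

wsum : ∀ {m} → (Fin m → ℚ) → Subset m → ℚ
wsum {zero}  w []          = 0ℚ
wsum {suc m} w (true ∷ s)  = w zero + wsum (λ i → w (suc i)) s
wsum {suc m} w (false ∷ s) = wsum (λ i → w (suc i)) s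

Separable : Graph → Set
Separable G = Σ (Fin (m G) → ℚ) λ w → Σ ℚ λ α →
  (∀ e → 0ℚ ≤ℚ w e) ×
  (∀ (E' : Subset (m G)) → (α ≤ℚ wsum w E') ⇔ Connected G E')

-- Elementary path with ℓ edges: injective vertex sequence p 0, …, p ℓ.
PathEdge : ∀ {N ℓ} → (Fin (suc ℓ) → Fin N) → Fin N → Fin N → Set
PathEdge {ℓ = ℓ} p u v = ∃ λ (i : Fin ℓ) → Link (p (inject₁ i)) (p (suc i)) u v

-- Elementary cycle of length k+1: injective c 0, …, c k, edges c i c (i+1)
-- and the closing edge c k c 0.
CycleEdge : ∀ {N k} → (Fin (suc k) → Fin N) → Fin N → Fin N → Set
CycleEdge {k = k} c u v = PathEdge c u v ⊎ Link (c (fromℕ k)) (c zero) u v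

record TwoCyclesAndPath (G : Graph) : Set where
  field
    k k' ℓ : ℕ
    c   : Fin (suc k)  → Fin (n G)
    c'  : Fin (suc k') → Fin (n G)
    p   : Fin (suc ℓ)  → Fin (n G)
    k≥2  : 2 ≤ k          -- C has length k+1 ≥ 3
    k'≥2 : 2 ≤ k'         -- C' has length k'+1 ≥ 3
    ℓ≥1  : 1 ≤ ℓ
    c-inj  : Injective _≡_ _≡_ c
    c'-inj : Injective _≡_ _≡_ c'
    p-inj  : Injective _≡_ _≡_ p
    disjoint : ∀ i j → c i ≢ c' j
    start : ∃ λ i → p zero ≡ c i
    end   : ∃ λ j → p (fromℕ ℓ) ≡ c' j
    internal : ∀ i → i ≢ zero → i ≢ fromℕ ℓ → (∀ j → p i ≢ c j) × (∀ j → p i ≢ c' j)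
    vertices : ∀ x → (∃ λ i → x ≡ c i) ⊎ (∃ λ i → x ≡ c' i) ⊎ (∃ λ i → x ≡ p i)
    edges : ∀ u v → GEdge G u v ⇔ (CycleEdge c u v ⊎ CycleEdge c' u v ⊎ PathEdge p u v)

-- Each cycle has a vertex of degree two: any vertex other than the one where the path
-- attaches. Let e₁, e₂ be the two edges at such a vertex of C and f₁, f₂ those at such a
-- vertex of C'. Deleting e₁ and f₁, or e₂ and f₂, leaves G connected (each cycle becomes a
-- path and the joining path is untouched), while deleting e₁ and e₂, or f₁ and f₂, isolates
-- a vertex. But w(E∖{e₁,f₁}) + w(E∖{e₂,f₂}) = w(E∖{e₁,e₂}) + w(E∖{f₁,f₂}), where the left
-- side is at least 2α and the right side is less than 2α.

module Submission where

open import Defs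
open import Relation.Nullary using (¬_; yes; no)

open import Data.Nat using (suc; z≤n; s≤s) renaming (_≤_ to _≤ℕ_)
import Data.Nat.Properties as ℕ
open import Data.Fin using (Fin; zero; suc; fromℕ; inject₁; _≟_)
  renaming (_<_ to _<ᶠ_; _≤_ to _≤ᶠ_; _≤?_ to _≤ᶠ?_)
open import Data.Fin.Properties using (0≢1+n; suc-injective; inject₁-injective; fromℕ≢inject₁)
open import Data.Fin.Subset using (Subset; _∈_; _∉_; _─_; ⁅_⁆; ⊤; ⊥; inside; outside)
  renaming (_-_ to _∖_)
open import Data.Fin.Subset.Properties using (∈⊤; p─⊥≡p; p─q⊆p; x∈p∧x≢y⇒x∈p-y)
open import Data.Vec using (_∷_; here; there)
open import Data.Rational using (ℚ; _+_; _-_; -_; _<_)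
import Data.Rational.Properties as ℚ
open import Data.Rational.Solver using (module +-*-Solver)
open import Data.Product using (∃; _×_; _,_; proj₁; proj₂)
open import Data.Sum using (_⊎_; inj₁; inj₂; swap)
open import Data.Empty using (⊥-elim)
open import Relation.Binary.Definitions using (Symmetric)
open import Relation.Binary.PropositionalEquality
open import Relation.Binary.Construct.Closure.ReflexiveTransitive using (Star; ε; _◅_; _◅◅_; reverse)
open import Function using (id; _∘_; Injective)
open import Function.Bundles using (Equivalence)

x∉p∖x : ∀ {n} (p : Subset n) (x : Fin n) → x ∉ p ∖ x
x∉p∖x (_ ∷ p) zero    ()
x∉p∖x (_ ∷ p) (suc x) (there x∈p∖x) = x∉p∖x p x x∈p∖x

x∉p∖x∖y : ∀ {n} (p : Subset n) (x y : Fin n) → x ∉ p ∖ x ∖ y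
x∉p∖x∖y p x y = x∉p∖x p x ∘ p─q⊆p (p ∖ x) ⁅ y ⁆

wsum-∖ : ∀ {m} (w : Fin m → ℚ) {p : Subset m} {x : Fin m} → x ∈ p →
         wsum w (p ∖ x) ≡ wsum w p - w x
wsum-∖ w {inside ∷ p} here = begin
  wsum (w ∘ suc) (p ─ ⊥)             ≡⟨ cong (wsum (w ∘ suc)) (p─⊥≡p p) ⟩
  wsum (w ∘ suc) p                   ≡⟨ solve 2 (λ a b → b := a :+ b :- a) refl (w zero) _ ⟩
  w zero + wsum (w ∘ suc) p - w zero ∎
  where
  open ≡-Reasoning
  open +-*-Solver
wsum-∖ w {inside ∷ p} {suc x} (there x∈p) =
  trans (cong (w zero +_) (wsum-∖ (w ∘ suc) x∈p))
        (sym (ℚ.+-assoc (w zero) (wsum (w ∘ suc) p) (- w (suc x))))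
wsum-∖ w {outside ∷ p} (there x∈p) = wsum-∖ (w ∘ suc) x∈p

wsum-⊤∖∖ : ∀ {m} (w : Fin m → ℚ) {a b : Fin m} → b ≢ a →
           wsum w (⊤ ∖ a ∖ b) ≡ wsum w ⊤ - w a - w b
wsum-⊤∖∖ w {a} {b} b≢a = begin
  wsum w (⊤ ∖ a ∖ b)   ≡⟨ wsum-∖ w (x∈p∧x≢y⇒x∈p-y ∈⊤ b≢a) ⟩
  wsum w (⊤ ∖ a) - w b ≡⟨ cong (_- w b) (wsum-∖ w ∈⊤) ⟩
  wsum w ⊤ - w a - w b ∎
  where open ≡-Reasoning

wsum-exchange : ∀ {m} (w : Fin m → ℚ) {a b c d : Fin m} →
                b ≢ a → d ≢ c → c ≢ a → d ≢ b →
                wsum w (⊤ ∖ a ∖ b) + wsum w (⊤ ∖ c ∖ d) ≡ wsum w (⊤ ∖ a ∖ c) + wsum w (⊤ ∖ b ∖ d)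
wsum-exchange w {a} {b} {c} {d} b≢a d≢c c≢a d≢b = begin
  wsum w (⊤ ∖ a ∖ b) + wsum w (⊤ ∖ c ∖ d)
    ≡⟨ cong₂ _+_ (wsum-⊤∖∖ w b≢a) (wsum-⊤∖∖ w d≢c) ⟩
  (W - w a - w b) + (W - w c - w d)
    ≡⟨ solve 5 (λ W a b c d → (W :- a :- b) :+ (W :- c :- d) := (W :- a :- c) :+ (W :- b :- d))
             refl W (w a) (w b) (w c) (w d) ⟩
  (W - w a - w c) + (W - w b - w d)
    ≡⟨ sym (cong₂ _+_ (wsum-⊤∖∖ w c≢a) (wsum-⊤∖∖ w d≢b)) ⟩
  wsum w (⊤ ∖ a ∖ c) + wsum w (⊤ ∖ b ∖ d) ∎
  where
  open ≡-Reasoning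
  open +-*-Solver
  W : ℚ
  W = wsum w ⊤

¬separable-by-exchange : ∀ (G : Graph) {A B C D : Subset (m G)} →
  (∀ w → wsum w A + wsum w B ≡ wsum w C + wsum w D) →
  Connected G A → Connected G B → ¬ Connected G C → ¬ Connected G D → ¬ Separable G
¬separable-by-exchange G {A} {B} {C} {D} exchange A-conn B-conn ¬C-conn ¬D-conn (w , α , _ , sep) =
  ℚ.<-irrefl refl (begin-strict
    α + α               ≤⟨ ℚ.+-mono-≤ (from (sep A) A-conn) (from (sep B) B-conn) ⟩
    wsum w A + wsum w B ≡⟨ exchange w ⟩
    wsum w C + wsum w D <⟨ ℚ.+-mono-< (below C ¬C-conn) (below D ¬D-conn) ⟩
    α + α               ∎)
  where
  open ℚ.≤-Reasoning
  open Equivalence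
  below : ∀ E → ¬ Connected G E → wsum w E < α
  below E ¬E-conn = ℚ.≰⇒> (¬E-conn ∘ to (sep E))

module _ {A : Set} {R : A → A → Set} where

  star-via : Symmetric R → ∀ {I : Set} {f : I → A} {h : A} →
             (∀ i → Star R (f i) h) → ∀ i j → Star R (f i) (f j)
  star-via sym to-h i j = to-h i ◅◅ reverse sym (to-h j)

  walk-down : ∀ {ℓ} (p : Fin (suc ℓ) → A) (j : Fin (suc ℓ)) →
              (∀ (i : Fin ℓ) → i <ᶠ j → R (p (suc i)) (p (inject₁ i))) → Star R (p j) (p zero)
  walk-down p zero h = ε
  walk-down {suc ℓ} p (suc j) h =
    walk-down (p ∘ suc) j (λ i i<j → h (suc i) (s≤s i<j)) ◅◅ (h zero (s≤s z≤n) ◅ ε)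

  walk-up : ∀ {ℓ} (p : Fin (suc ℓ) → A) (j : Fin (suc ℓ)) →
            (∀ (i : Fin ℓ) → j ≤ᶠ i → R (p (inject₁ i)) (p (suc i))) → Star R (p j) (p (fromℕ ℓ))
  walk-up {0}     p zero    h = ε
  walk-up {suc ℓ} p zero    h = h zero z≤n ◅ walk-up (p ∘ suc) zero (λ i _ → h (suc i) z≤n)
  walk-up {suc ℓ} p (suc j) h = walk-up (p ∘ suc) j (λ i j≤i → h (suc i) (s≤s j≤i))

  path-to-start : Symmetric R → ∀ {ℓ} (p : Fin (suc ℓ) → A) →
                  (∀ i → R (p (inject₁ i)) (p (suc i))) → ∀ j → Star R (p j) (p zero)
  path-to-start sym p h j = walk-down p j (λ i _ → sym (h i))

  cycle-minus-edge-to-start : Symmetric R → ∀ {K} (c : Fin (suc K) → A) (r : Fin K) →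
    (∀ i → i ≢ r → R (c (inject₁ i)) (c (suc i))) → R (c (fromℕ K)) (c zero) →
    ∀ j → Star R (c j) (c zero)
  cycle-minus-edge-to-start sym c r h closing j with j ≤ᶠ? r
  ... | yes j≤r = walk-down c j (λ i i<j → sym (h i (λ { refl → ℕ.<-irrefl refl (ℕ.<-≤-trans i<j j≤r) })))
  ... | no  j≰r = walk-up c j (λ i j≤i → h i (λ { refl → j≰r j≤i })) ◅◅ (closing ◅ ε)

inject₁≡suc⇒suc≢inject₁ : ∀ {ℓ} {i r : Fin ℓ} → inject₁ r ≡ suc i → suc r ≢ inject₁ i
inject₁≡suc⇒suc≢inject₁ {r = zero}          ()
inject₁≡suc⇒suc≢inject₁ {i = zero}  {suc r} _   ()
inject₁≡suc⇒suc≢inject₁ {i = suc i} {suc r} eq₁ eq₂ =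
  inject₁≡suc⇒suc≢inject₁ (suc-injective eq₁) (suc-injective eq₂)

module _ {N ℓ} {p : Fin (suc ℓ) → Fin N} (p-inj : Injective _≡_ _≡_ p) where

  path-links-distinct : ∀ {i r} → i ≢ r → ¬ Link (p (inject₁ i)) (p (suc i)) (p (inject₁ r)) (p (suc r))
  path-links-distinct i≢r (inj₁ (eq , _))   = i≢r (sym (inject₁-injective (p-inj eq)))
  path-links-distinct i≢r (inj₂ (eq₁ , eq₂)) = inject₁≡suc⇒suc≢inject₁ (p-inj eq₁) (p-inj eq₂)

module _ {N ℓ} {p : Fin (suc (suc ℓ)) → Fin N} (p-inj : Injective _≡_ _≡_ p) where

  first-link-index : ∀ {i y} → Link (p (inject₁ i)) (p (suc i)) (p zero) y → i ≡ zero
  first-link-index {zero}  _               = refl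
  first-link-index {suc i} (inj₁ (eq , _)) = ⊥-elim (0≢1+n (p-inj eq))
  first-link-index {suc i} (inj₂ (eq , _)) = ⊥-elim (0≢1+n (p-inj eq))

  last-link-index : ∀ {i y} → Link (p (inject₁ i)) (p (suc i)) (p (fromℕ (suc ℓ))) y → i ≡ fromℕ ℓ
  last-link-index (inj₁ (eq , _)) = ⊥-elim (fromℕ≢inject₁ (p-inj eq))
  last-link-index (inj₂ (eq , _)) = sym (suc-injective (p-inj eq))

Link-swap : ∀ {N} {a b u v : Fin N} → Link a b u v → Link a b v u
Link-swap (inj₁ (p , q)) = inj₂ (q , p)
Link-swap (inj₂ (p , q)) = inj₁ (q , p)

Link-sym : ∀ {N} {a b u v : Fin N} → Link a b u v → Link u v a b
Link-sym (inj₁ (p , q)) = inj₁ (sym p , sym q)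
Link-sym (inj₂ (p , q)) = inj₂ (sym q , sym p)

Link-trans : ∀ {N} {a b u v x y : Fin N} → Link a b u v → Link u v x y → Link a b x y
Link-trans (inj₁ (refl , refl)) l = l
Link-trans (inj₂ (refl , refl)) l = swap l

module _ (G : Graph) where

  Joins : Fin (m G) → Fin (n G) → Fin (n G) → Set
  Joins e = Link (proj₁ (ends G e)) (proj₂ (ends G e))

  Within : ∀ {k} → (Fin k → Fin (n G)) → Fin (m G) → Set
  Within c e = (∃ λ i → proj₁ (ends G e) ≡ c i) × (∃ λ j → proj₂ (ends G e) ≡ c j)

  Removable : ∀ {k} → (Fin k → Fin (n G)) → Fin (m G) → Set
  Removable c x = ∀ T → (∀ e → Within c e → e ≢ x → e ∈ T) → ∀ i j → Star (Step G T) (c i) (c j)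

  -- Instantiated below by the two edges at a vertex of c that has degree two in G.
  record CutPair {k} (c : Fin k → Fin (n G)) : Set where
    field
      e₁ e₂        : Fin (m G)
      e₂≢e₁        : e₂ ≢ e₁
      e₁-within    : Within c e₁
      e₂-within    : Within c e₂
      e₁-removable : Removable c e₁
      e₂-removable : Removable c e₂
      cut          : ∀ T → e₁ ∉ T → e₂ ∉ T → ¬ Connected G T

    ⊤∖∖-disconnected : ¬ Connected G (⊤ ∖ e₁ ∖ e₂)
    ⊤∖∖-disconnected = cut _ (x∉p∖x∖y ⊤ e₁ e₂) (x∉p∖x (⊤ ∖ e₁) e₂)

  joins-unique : ∀ {e e' u v} → Joins e u v → Joins e' u v → e ≡ e'
  joins-unique J J' = simple G _ _ (Link-trans J (Link-sym J'))

  joins-≢ : ∀ {e e' u v u' v'} → Joins e u v → Joins e' u' v' → ¬ Link u v u' v' → e ≢ e'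
  joins-≢ J J' ¬L refl = ¬L (Link-trans (Link-sym J) J')

  joins-within : ∀ {k} {c : Fin k → Fin (n G)} {e i j} → Joins e (c i) (c j) → Within c e
  joins-within (inj₁ (p , q)) = (_ , sym p) , (_ , sym q)
  joins-within (inj₂ (p , q)) = (_ , sym q) , (_ , sym p)

  within-joins : ∀ {k} {c : Fin k → Fin (n G)} {e u v} → Within c e → Joins e u v → ∃ λ j → v ≡ c j
  within-joins (_ , (j , q)) (inj₁ (_ , refl)) = j , q
  within-joins ((i , p) , _) (inj₂ (_ , refl)) = i , p

  within-disjoint : ∀ {k k'} {c : Fin k → Fin (n G)} {c' : Fin k' → Fin (n G)} →
                    (∀ i j → c i ≢ c' j) → ∀ {x y} → Within c x → Within c' y → x ≢ y
  within-disjoint disjoint ((i , p) , _) ((j , q) , _) refl = disjoint i j (trans (sym p) q)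

  Step-sym : ∀ {T} → Symmetric (Step G T)
  Step-sym (e , e∈T , J) = e , e∈T , Link-swap J

  isolated⇒¬connected : ∀ {T u v} → u ≢ v → (∀ {y} → ¬ Step G T u y) → ¬ Connected G T
  isolated⇒¬connected {u = u} {v} u≢v isolated conn with conn u v
  ... | ε     = u≢v refl
  ... | s ◅ _ = isolated s

-- A cycle attached to the rest of the graph at a single vertex

module CycleAttachedAt (G : Graph) {k} (c : Fin (suc (suc (suc k))) → Fin (n G))
  (c-inj : Injective _≡_ _≡_ c)
  (cycle⊆G : ∀ {u v} → CycleEdge c u v → GEdge G u v)
  (s : Fin (suc (suc (suc k))))
  (away-from-s : ∀ {t y} → t ≢ s → GEdge G (c t) y → CycleEdge c (c t) y) where

  edge : Fin (suc (suc k)) → Fin (m G)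
  edge i = proj₁ (cycle⊆G (inj₁ (i , inj₁ (refl , refl))))

  edge-joins : ∀ i → Joins G (edge i) (c (inject₁ i)) (c (suc i))
  edge-joins i = proj₂ (cycle⊆G (inj₁ (i , inj₁ (refl , refl))))

  closing : Fin (m G)
  closing = proj₁ (cycle⊆G (inj₂ (inj₁ (refl , refl))))

  closing-joins : Joins G closing (c (fromℕ (suc (suc k)))) (c zero)
  closing-joins = proj₂ (cycle⊆G (inj₂ (inj₁ (refl , refl))))

  edge≢edge : ∀ {i r} → i ≢ r → edge i ≢ edge r
  edge≢edge i≢r = joins-≢ G (edge-joins _) (edge-joins _) (path-links-distinct c-inj i≢r)

  closing-link-distinct : ∀ i → ¬ Link (c (fromℕ (suc (suc k)))) (c zero) (c (inject₁ i)) (c (suc i))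
  closing-link-distinct i       (inj₁ (eq , _)) = fromℕ≢inject₁ (sym (c-inj eq))
  closing-link-distinct zero    (inj₂ (_ , eq)) = 0≢1+n (suc-injective (c-inj eq))
  closing-link-distinct (suc i) (inj₂ (eq , _)) = 0≢1+n (sym (c-inj eq))

  closing≢edge : ∀ i → closing ≢ edge i
  closing≢edge i = joins-≢ G closing-joins (edge-joins i) (closing-link-distinct i)

  module _ {T x} (keep : ∀ e → Within G c e → e ≢ x → e ∈ T) where

    step : ∀ {e i j} → Joins G e (c i) (c j) → e ≢ x → Step G T (c i) (c j)
    step J e≢x = _ , keep _ (joins-within G J) e≢x , J

  closing-removable : Removable G c closing
  closing-removable T keep = star-via (Step-sym G)
    (path-to-start (Step-sym G) c (λ i → step keep (edge-joins i) (closing≢edge i ∘ sym)))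

  edge-removable : ∀ r → Removable G c (edge r)
  edge-removable r T keep = star-via (Step-sym G)
    (cycle-minus-edge-to-start (Step-sym G) c r
      (λ i i≢r → step keep (edge-joins i) (edge≢edge i≢r))
      (step keep closing-joins (closing≢edge r)))

  edges-at : ∀ {t e y} → t ≢ s → Joins G e (c t) y →
             (∃ λ i → e ≡ edge i × Link (c (inject₁ i)) (c (suc i)) (c t) y) ⊎ e ≡ closing
  edges-at t≢s J with away-from-s t≢s (_ , J)
  ... | inj₁ (i , L) = inj₁ (i , joins-unique G (Link-trans J (Link-sym L)) (edge-joins i) , L)
  ... | inj₂ L       = inj₂ (joins-unique G (Link-trans J (Link-sym L)) closing-joins)

  first-isolated : s ≢ zero → ∀ {T} → closing ∉ T → edge zero ∉ T → ∀ {y} → ¬ Step G T (c zero) y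
  first-isolated s≢0 {T} closing∉T edge∉T (e , e∈T , J) with edges-at (s≢0 ∘ sym) J
  ... | inj₁ (i , refl , L) = edge∉T (subst (λ i → edge i ∈ T) (first-link-index c-inj L) e∈T)
  ... | inj₂ refl           = closing∉T e∈T

  last-isolated : s ≡ zero → ∀ {T} → closing ∉ T → edge (fromℕ (suc k)) ∉ T →
                  ∀ {y} → ¬ Step G T (c (fromℕ (suc (suc k)))) y
  last-isolated s≡0 {T} closing∉T edge∉T (e , e∈T , J)
    with edges-at (λ last≡s → 0≢1+n (sym (trans last≡s s≡0))) J
  ... | inj₁ (i , refl , L) = edge∉T (subst (λ i → edge i ∈ T) (last-link-index c-inj L) e∈T)
  ... | inj₂ refl           = closing∉T e∈T

  cutPair-with : ∀ r → (∀ T → closing ∉ T → edge r ∉ T → ¬ Connected G T) → CutPair G c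
  cutPair-with r cut = record
    { e₁ = closing ; e₂ = edge r ; e₂≢e₁ = closing≢edge r ∘ sym
    ; e₁-within = joins-within G closing-joins ; e₂-within = joins-within G (edge-joins r)
    ; e₁-removable = closing-removable ; e₂-removable = edge-removable r
    ; cut = cut }

  -- The vertex c 0 or the last vertex, whichever is not s, has degree two.
  cutPair : CutPair G c
  cutPair with s ≟ zero
  ... | no s≢0  = cutPair-with zero λ _ closing∉T edge∉T →
    isolated⇒¬connected G {v = c (suc zero)} (0≢1+n ∘ c-inj) (first-isolated s≢0 closing∉T edge∉T)
  ... | yes s≡0 = cutPair-with (fromℕ (suc k)) λ _ closing∉T edge∉T →
    isolated⇒¬connected G (0≢1+n ∘ sym ∘ c-inj) (last-isolated s≡0 closing∉T edge∉T)

cycle-cutPair : ∀ G {k} (c : Fin (suc k) → Fin (n G)) → 2 ≤ℕ k → Injective _≡_ _≡_ c →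
                (∀ {u v} → CycleEdge c u v → GEdge G u v) → (s : Fin (suc k)) →
                (∀ {t y} → t ≢ s → GEdge G (c t) y → CycleEdge c (c t) y) → CutPair G c
cycle-cutPair G c (s≤s (s≤s z≤n)) = CycleAttachedAt.cutPair G c

pathEdge-vertex : ∀ {N ℓ} {p : Fin (suc ℓ) → Fin N} {u v} → PathEdge p u v → ∃ λ i → u ≡ p i
pathEdge-vertex (i , inj₁ (eq , _)) = inject₁ i , eq
pathEdge-vertex (i , inj₂ (eq , _)) = suc i , eq

cycleEdge-vertex : ∀ {N k} {c : Fin (suc k) → Fin N} {u v} → CycleEdge c u v → ∃ λ i → u ≡ c i
cycleEdge-vertex (inj₁ e)               = pathEdge-vertex e
cycleEdge-vertex (inj₂ (inj₁ (eq , _))) = fromℕ _ , eq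
cycleEdge-vertex (inj₂ (inj₂ (eq , _))) = zero , eq

module TwoCyclesJoinedByPath {G : Graph} (R : TwoCyclesAndPath G) where
  open TwoCyclesAndPath R
  open Equivalence

  s : Fin (suc k)
  s = proj₁ start

  s' : Fin (suc k')
  s' = proj₁ end

  p≡c⇒zero : ∀ {i t} → p i ≡ c t → i ≡ zero
  p≡c⇒zero {i} {t} eq with i ≟ zero | i ≟ fromℕ ℓ
  ... | yes i≡0 | _        = i≡0
  ... | no _    | yes refl = ⊥-elim (disjoint t s' (trans (sym eq) (proj₂ end)))
  ... | no i≢0  | no i≢ℓ   = ⊥-elim (proj₁ (internal i i≢0 i≢ℓ) t eq)

  p≡c'⇒last : ∀ {i t} → p i ≡ c' t → i ≡ fromℕ ℓ
  p≡c'⇒last {i} {t} eq with i ≟ fromℕ ℓ | i ≟ zero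
  ... | yes i≡ℓ | _        = i≡ℓ
  ... | no _    | yes refl = ⊥-elim (disjoint s t (trans (sym (proj₂ start)) eq))
  ... | no i≢ℓ  | no i≢0   = ⊥-elim (proj₂ (internal i i≢0 i≢ℓ) t eq)

  c≡p⇒s : ∀ {t i} → c t ≡ p i → t ≡ s
  c≡p⇒s ct≡pi = c-inj (trans ct≡pi (trans (cong p (p≡c⇒zero (sym ct≡pi))) (proj₂ start)))

  c'≡p⇒s' : ∀ {t i} → c' t ≡ p i → t ≡ s'
  c'≡p⇒s' c't≡pi = c'-inj (trans c't≡pi (trans (cong p (p≡c'⇒last (sym c't≡pi))) (proj₂ end)))

  away-from-s : ∀ {t y} → t ≢ s → GEdge G (c t) y → CycleEdge c (c t) y
  away-from-s {t} t≢s e with to (edges _ _) e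
  ... | inj₁ e∈C         = e∈C
  ... | inj₂ (inj₁ e∈C') = ⊥-elim (disjoint t _ (proj₂ (cycleEdge-vertex {c = c'} e∈C')))
  ... | inj₂ (inj₂ e∈P)  = ⊥-elim (t≢s (c≡p⇒s (proj₂ (pathEdge-vertex {p = p} e∈P))))

  away-from-s' : ∀ {t y} → t ≢ s' → GEdge G (c' t) y → CycleEdge c' (c' t) y
  away-from-s' {t} t≢s' e with to (edges _ _) e
  ... | inj₁ e∈C         = ⊥-elim (disjoint _ t (sym (proj₂ (cycleEdge-vertex {c = c} e∈C))))
  ... | inj₂ (inj₁ e∈C') = e∈C'
  ... | inj₂ (inj₂ e∈P)  = ⊥-elim (t≢s' (c'≡p⇒s' (proj₂ (pathEdge-vertex {p = p} e∈P))))

  C-cutPair : CutPair G c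
  C-cutPair = cycle-cutPair G c k≥2 c-inj (λ e → from (edges _ _) (inj₁ e)) s away-from-s

  C'-cutPair : CutPair G c'
  C'-cutPair = cycle-cutPair G c' k'≥2 c'-inj (λ e → from (edges _ _) (inj₂ (inj₁ e))) s' away-from-s'

  C-edge≢C'-edge : ∀ {x y} → Within G c x → Within G c' y → x ≢ y
  C-edge≢C'-edge = within-disjoint G disjoint

  path-edge : Fin ℓ → Fin (m G)
  path-edge i = proj₁ (from (edges _ _) (inj₂ (inj₂ (i , inj₁ (refl , refl)))))

  path-edge-joins : ∀ i → Joins G (path-edge i) (p (inject₁ i)) (p (suc i))
  path-edge-joins i = proj₂ (from (edges _ _) (inj₂ (inj₂ (i , inj₁ (refl , refl)))))

  path-edge-¬within-C : ∀ i → ¬ Within G c (path-edge i)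
  path-edge-¬within-C i within =
    0≢1+n (sym (p≡c⇒zero (proj₂ (within-joins G within (path-edge-joins i)))))

  path-edge-¬within-C' : ∀ i → ¬ Within G c' (path-edge i)
  path-edge-¬within-C' i within =
    fromℕ≢inject₁ (sym (p≡c'⇒last (proj₂ (within-joins G within (Link-swap (path-edge-joins i))))))

  connected-if-cycles-linked : ∀ {T} → (∀ i j → Star (Step G T) (c i) (c j)) →
                               (∀ i j → Star (Step G T) (c' i) (c' j)) →
                               (∀ i → path-edge i ∈ T) → Connected G T
  connected-if-cycles-linked {T} C-linked C'-linked P⊆T = star-via (Step-sym G) {f = id} to-start
    where
    along-P : ∀ i → Star (Step G T) (p i) (p zero)
    along-P = path-to-start (Step-sym G) p (λ i → path-edge i , P⊆T i , path-edge-joins i)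
    to-start : ∀ u → Star (Step G T) u (p zero)
    to-start u with vertices u
    ... | inj₁ (i , refl)        = subst (Star (Step G T) (c i)) (sym (proj₂ start)) (C-linked i s)
    ... | inj₂ (inj₁ (i , refl)) =
      subst (Star (Step G T) (c' i)) (sym (proj₂ end)) (C'-linked i s') ◅◅ along-P (fromℕ ℓ)
    ... | inj₂ (inj₂ (i , refl)) = along-P i

  ⊤∖∖-connected : ∀ {x y} → Within G c x → Removable G c x → Within G c' y → Removable G c' y →
                  Connected G (⊤ ∖ x ∖ y)
  ⊤∖∖-connected {x} {y} x∈C x-removable y∈C' y-removable = connected-if-cycles-linked
    (x-removable _ λ e e∈C e≢x → kept e≢x (C-edge≢C'-edge e∈C y∈C'))
    (y-removable _ λ e e∈C' e≢y → kept (C-edge≢C'-edge x∈C e∈C' ∘ sym) e≢y)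
    (λ i → kept (λ { refl → path-edge-¬within-C i x∈C }) (λ { refl → path-edge-¬within-C' i y∈C' }))
    where
    kept : ∀ {e} → e ≢ x → e ≢ y → e ∈ ⊤ ∖ x ∖ y
    kept e≢x e≢y = x∈p∧x≢y⇒x∈p-y (x∈p∧x≢y⇒x∈p-y ∈⊤ e≢x) e≢y

corollary5 : (G : Graph) → TwoCyclesAndPath G → ¬ Separable G
corollary5 G R = ¬separable-by-exchange G
  (λ w → wsum-exchange w (C-edge≢C'-edge X.e₁-within Y.e₁-within ∘ sym)
                         (C-edge≢C'-edge X.e₂-within Y.e₂-within ∘ sym) X.e₂≢e₁ Y.e₂≢e₁)
  (⊤∖∖-connected X.e₁-within X.e₁-removable Y.e₁-within Y.e₁-removable)
  (⊤∖∖-connected X.e₂-within X.e₂-removable Y.e₂-within Y.e₂-removable)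
  X.⊤∖∖-disconnected
  Y.⊤∖∖-disconnected
  where
  open TwoCyclesJoinedByPath R
  module X = CutPair C-cutPair
  module Y = CutPair C'-cutPair
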